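{- For every integer $a\ge 0$, the sequences $(\mathcal{G}(0,a,2a+i))_{i\ge 0}$ and $(\mathcal{G}(0,a+i,2a+i))_{i\ge 0}$ are identical.
   Context: Three-pile Sharing Nim: a position is a triple of nonnegative integers (pile sizes; order irrelevant). A move takes some positive number $k$ of tokens from one pile and adds them to another pile, provided that after the move the receiving pile does not have more tokens than the source pile; i.e. from $(a,b,c)$ with $a\le b\le c$ one may move to $(a+k,b-k,c)$ with $1\le k\le (b-a)/2$, to $(a+k,b,c-k)$ with $1\le k\le (c-a)/2$, or to $(a,b+k,c-k)$ with $1\le k\le (c-b)/2$. Normal play. $\mathcal{G}$ denotes the Sprague–Grundy value: $\mathcal{G}(p)=\operatorname{mex}\{\mathcal{G}(q): q \text{ reachable from } p \text{ in one move}\}$, where $\operatorname{mex}(S)$ is the least nonnegative integer not in $S$. -}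

module Defs where

open import Data.Nat using (ℕ; zero; suc; _+_; _*_; _∸_; _≟_)
open import Data.Nat.DivMod using (_/_)
open import Data.List using (List; []; _∷_; map; _++_; length; concatMap)
open import Data.Product using (_×_; _,_)
open import Relation.Nullary using (yes; no)
open import Data.Bool using (Bool; true; false)

-- Order is irrelevant for the game; the move generator below treats all
-- three piles symmetrically, so no normalisation is needed.
Pos : Set
Pos = ℕ × ℕ × ℕ

range1 : ℕ → List ℕ
range1 zero    = []
range1 (suc n) = range1 n ++ (suc n ∷ [])

-- Amounts k ≥ 1 that may be moved from a pile of size x to a pile of size y
-- such that afterwards y + k ≤ x - k, i.e. 1 ≤ k ≤ (x - y)/2.
amounts : ℕ → ℕ → List ℕ
amounts x y = range1 ((x ∸ y) / 2)

moves : Pos → List Pos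
moves (a , b , c) =
     map (λ k → (a ∸ k , b + k , c)) (amounts a b)
  ++ map (λ k → (a ∸ k , b , c + k)) (amounts a c)
  ++ map (λ k → (a + k , b ∸ k , c)) (amounts b a)
  ++ map (λ k → (a , b ∸ k , c + k)) (amounts b c)
  ++ map (λ k → (a + k , b , c ∸ k)) (amounts c a)
  ++ map (λ k → (a , b + k , c ∸ k)) (amounts c b)

elem : ℕ → List ℕ → Bool
elem n []       = false
elem n (m ∷ ms) with n ≟ m
... | yes _ = true
... | no  _ = elem n ms

mexFrom : ℕ → ℕ → List ℕ → ℕ
mexFrom zero    n l = n
mexFrom (suc f) n l with elem n l
... | true  = mexFrom f (suc n) l
... | false = n

-- mex of a finite list: the least natural not in the list.
-- (Among 0..length l at least one value is missing, so length l + 1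
--  candidates always suffice and the result is exactly the mex.)
mex : List ℕ → ℕ
mex l = mexFrom (suc (length l)) 0 l

-- Every move strictly decreases the sum of squares
-- of the piles (moving k with 2k ≤ x - y from x to y), so fuel
-- a² + b² + c² + 1 is always enough and Grundy computes the true SG value.
grundyFuel : ℕ → Pos → ℕ
grundyFuel zero    p = 0
grundyFuel (suc f) p = mex (map (grundyFuel f) (moves p))

sqSum : Pos → ℕ
sqSum (a , b , c) = a * a + b * b + c * c

𝒢 : Pos → ℕ
𝒢 p = grundyFuel (suc (sqSum p)) p

-- Reflecting every pile through a bound c, (x , y , z) ↦ (c ∸ z , c ∸ y , c ∸ x), maps the
-- moves of a position bijectively onto those of its mirror image: sending k tokens from a
-- pile u to a pile v becomes sending k tokens from c ∸ v to c ∸ u, and the condition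
-- 2k ≤ u ∸ v is unchanged.  Hence the Grundy value is invariant under this reflection, and
-- for c = 2a + i it maps (0 , a , 2a + i) to (0 , a + i , 2a + i).
module Submission where

open import Defs
import Algebra.Solver.CommutativeMonoid as CommutativeMonoidSolver
open import Data.Bool using (true; false)
open import Data.List using (List; _∷_; map; _++_)
open import Data.List.Membership.Propositional using (_∈_)
open import Data.List.Membership.Propositional.Properties using (∈-++⁻)
open import Data.List.Properties using (map-∘; map-++; map-cong-local)
open import Data.List.Relation.Binary.Permutation.Propositional
  using (_↭_; refl; prep; swap; trans; ↭-refl; ↭-trans; ↭-reflexive)
import Data.List.Relation.Binary.Permutation.Propositional.Properties as ↭
open import Data.List.Relation.Unary.All as All using (All)
import Data.List.Relation.Unary.All.Properties as All
open import Data.List.Relation.Unary.Any using (here)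
open import Data.Nat using (ℕ; zero; suc; _+_; _*_; _∸_; _≤_; _<_; z≤n; s≤s; _≟_)
open import Data.Nat.DivMod using (_/_; m/n*n≤m)
open import Data.Nat.Properties
open import Algebra.Properties.CommutativeSemigroup +-commutativeSemigroup
  using (xy∙z≈xz∙y; xy∙z≈yx∙z; xy∙z≈zx∙y; xy∙z≈yz∙x; xy∙z≈zy∙x)
open import Data.Nat.Tactic.RingSolver using (solve-∀)
open import Data.Product using (_×_; _,_; map₂)
open import Data.Sum using (inj₁; inj₂)
open import Function using (_∘_)
open import Relation.Nullary using (yes; no; contradiction)
open import Relation.Binary.PropositionalEquality
  using (_≡_; _≢_; refl; sym; cong; cong₂; subst; subst₂; module ≡-Reasoning)
  renaming (trans to ≡-trans)

record Legal (u v k : ℕ) : Set where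
  field
    positive : 1 ≤ k
    room     : v + (k + k) ≤ u

open Legal

∈-range1⁻ : ∀ {k n} → k ∈ range1 n → 1 ≤ k × k ≤ n
∈-range1⁻ {n = suc n} k∈ with ∈-++⁻ (range1 n) k∈
... | inj₁ k∈range = map₂ m≤n⇒m≤1+n (∈-range1⁻ k∈range)
... | inj₂ (here refl) = s≤s z≤n , ≤-refl

m≤n/2⇒m+m≤n : ∀ m n → m ≤ n / 2 → m + m ≤ n
m≤n/2⇒m+m≤n m n m≤n/2 = begin
  m + m        ≡⟨ cong (m +_) (+-identityʳ m) ⟨
  2 * m        ≡⟨ *-comm 2 m ⟩
  m * 2        ≤⟨ *-monoˡ-≤ 2 m≤n/2 ⟩
  n / 2 * 2    ≤⟨ m/n*n≤m n 2 ⟩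
  n            ∎
  where open ≤-Reasoning

∈-amounts⁻ : ∀ {u v k} → k ∈ amounts u v → Legal u v k
∈-amounts⁻ {u} {v} {k} k∈ with ∈-range1⁻ k∈
... | 1≤k , k≤ = record { positive = 1≤k ; room = v+2k≤u }
  where
  2k≤u∸v : k + k ≤ u ∸ v
  2k≤u∸v = m≤n/2⇒m+m≤n k (u ∸ v) k≤
  v<u : v < u
  v<u = m∸n≢0⇒n<m (>⇒≢ (≤-trans 1≤k (≤-trans (m≤m+n k k) 2k≤u∸v)))
  v+2k≤u : v + (k + k) ≤ u
  v+2k≤u = begin
    v + (k + k)  ≤⟨ +-monoʳ-≤ v 2k≤u∸v ⟩
    v + (u ∸ v)  ≡⟨ m+[n∸m]≡n (<⇒≤ v<u) ⟩
    u            ∎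
    where open ≤-Reasoning

target≤source : ∀ {u v k} → Legal u v k → v + k ≤ u
target≤source {v = v} {k} legal = ≤-trans (+-monoʳ-≤ v (m≤m+n k k)) (room legal)

amount≤source : ∀ {u v k} → Legal u v k → k ≤ u
amount≤source {v = v} {k} legal = ≤-trans (m≤n+m k v) (target≤source legal)

infix 4 _⟶_

data _⟶_ : Pos → Pos → Set where
  a→b : ∀ {a b c k} → Legal a b k → (a , b , c) ⟶ (a ∸ k , b + k , c)
  a→c : ∀ {a b c k} → Legal a c k → (a , b , c) ⟶ (a ∸ k , b , c + k)
  b→a : ∀ {a b c k} → Legal b a k → (a , b , c) ⟶ (a + k , b ∸ k , c)
  b→c : ∀ {a b c k} → Legal b c k → (a , b , c) ⟶ (a , b ∸ k , c + k)
  c→a : ∀ {a b c k} → Legal c a k → (a , b , c) ⟶ (a + k , b , c ∸ k)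
  c→b : ∀ {a b c k} → Legal c b k → (a , b , c) ⟶ (a , b + k , c ∸ k)

-- `place s t` is the position whose source pile is s and whose target pile is t.
transfers : (ℕ → ℕ → Pos) → ℕ → ℕ → List Pos
transfers place u v = map (λ k → place (u ∸ k) (v + k)) (amounts u v)

All-transfers : ∀ {P : Pos → Set} {u v} place →
  (∀ {k} → Legal u v k → P (place (u ∸ k) (v + k))) → All P (transfers place u v)
All-transfers place h = All.map⁺ (All.tabulate (h ∘ ∈-amounts⁻))

moves-sound : ∀ p → All (p ⟶_) (moves p)
moves-sound (a , b , c) =
  All.++⁺ (All-transfers (λ s t → s , t , c) a→b) (All.++⁺ (All-transfers (λ s t → s , b , t) a→c)
  (All.++⁺ (All-transfers (λ s t → t , s , c) b→a) (All.++⁺ (All-transfers (λ s t → a , s , t) b→c)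
  (All.++⁺ (All-transfers (λ s t → t , b , s) c→a) (All-transfers (λ s t → a , t , s) c→b)))))

-- With w = v + k + d the two sides differ by 2k(k + d), which is positive as k ≥ 1.
transfer-decreases-sq : ∀ {v w k} → 1 ≤ k → v + k ≤ w →
  w * w + (v + k) * (v + k) < (w + k) * (w + k) + v * v
transfer-decreases-sq {v} {k = suc m} _ v+k≤w with m≤n⇒∃[o]m+o≡n v+k≤w
... | d , refl = <-≤-trans (m<m+n _ (s≤s z≤n)) (≤-reflexive (sym (expand v (suc m) d)))
  where
  expand : ∀ v k d → (v + k + d + k) * (v + k + d + k) + v * v
    ≡ (v + k + d) * (v + k + d) + (v + k) * (v + k) + 2 * k * (k + d)
  expand = solve-∀

transfer-decreases-sqSum : ∀ u v w {k} → Legal u v k →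
  sqSum (u ∸ k , v + k , w) < sqSum (u , v , w)
transfer-decreases-sqSum u v w {k} legal =
  subst (λ u′ → sqSum (u ∸ k , v + k , w) < sqSum (u′ , v , w)) (m∸n+n≡m (amount≤source legal))
    (+-monoˡ-< (w * w) (transfer-decreases-sq (positive legal) v+k≤u∸k))
  where
  v+k≤u∸k : v + k ≤ u ∸ k
  v+k≤u∸k = m+n≤o⇒m≤o∸n (v + k) (subst (_≤ u) (sym (+-assoc v k k)) (room legal))

sqSum-xzy : ∀ x y z → sqSum (x , z , y) ≡ sqSum (x , y , z)
sqSum-xzy x y z = xy∙z≈xz∙y (x * x) (z * z) (y * y)

sqSum-yxz : ∀ x y z → sqSum (y , x , z) ≡ sqSum (x , y , z)
sqSum-yxz x y z = xy∙z≈yx∙z (y * y) (x * x) (z * z)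

sqSum-yzx : ∀ x y z → sqSum (y , z , x) ≡ sqSum (x , y , z)
sqSum-yzx x y z = xy∙z≈zx∙y (y * y) (z * z) (x * x)

sqSum-zxy : ∀ x y z → sqSum (z , x , y) ≡ sqSum (x , y , z)
sqSum-zxy x y z = xy∙z≈yz∙x (z * z) (x * x) (y * y)

sqSum-zyx : ∀ x y z → sqSum (z , y , x) ≡ sqSum (x , y , z)
sqSum-zyx x y z = xy∙z≈zy∙x (z * z) (y * y) (x * x)

⟶-decreases-sqSum : ∀ {p q} → p ⟶ q → sqSum q < sqSum p
⟶-decreases-sqSum (a→b {a} {b} {c} legal) = transfer-decreases-sqSum a b c legal
⟶-decreases-sqSum (a→c {a} {b} {c} {k} legal) =
  subst₂ _<_ (sqSum-xzy (a ∸ k) b (c + k)) (sqSum-xzy a b c) (transfer-decreases-sqSum a c b legal)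
⟶-decreases-sqSum (b→a {a} {b} {c} {k} legal) =
  subst₂ _<_ (sqSum-yxz (a + k) (b ∸ k) c) (sqSum-yxz a b c) (transfer-decreases-sqSum b a c legal)
⟶-decreases-sqSum (b→c {a} {b} {c} {k} legal) =
  subst₂ _<_ (sqSum-yzx a (b ∸ k) (c + k)) (sqSum-yzx a b c) (transfer-decreases-sqSum b c a legal)
⟶-decreases-sqSum (c→a {a} {b} {c} {k} legal) =
  subst₂ _<_ (sqSum-zxy (a + k) b (c ∸ k)) (sqSum-zxy a b c) (transfer-decreases-sqSum c a b legal)
⟶-decreases-sqSum (c→b {a} {b} {c} {k} legal) =
  subst₂ _<_ (sqSum-zyx a (b + k) (c ∸ k)) (sqSum-zyx a b c) (transfer-decreases-sqSum c b a legal)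

elem-∷-≡ : ∀ {n x xs} → n ≡ x → elem n (x ∷ xs) ≡ true
elem-∷-≡ {n} refl with n ≟ n
... | yes _ = refl
... | no n≢n = contradiction refl n≢n

elem-∷-≢ : ∀ {n x xs} → n ≢ x → elem n (x ∷ xs) ≡ elem n xs
elem-∷-≢ {n} {x} n≢x with n ≟ x
... | yes n≡x = contradiction n≡x n≢x
... | no _ = refl

elem-↭ : ∀ {n} {xs ys : List ℕ} → xs ↭ ys → elem n xs ≡ elem n ys
elem-↭ refl = refl
elem-↭ {n} (prep x xs↭ys) with n ≟ x
... | yes _ = refl
... | no _ = elem-↭ xs↭ys
elem-↭ {n} (swap x y xs↭ys) with n ≟ x | n ≟ y
... | yes _   | yes _   = refl
... | yes n≡x | no _    = sym (elem-∷-≡ n≡x)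
... | no _    | yes n≡y = elem-∷-≡ n≡y
... | no n≢x  | no n≢y  = ≡-trans (elem-∷-≢ n≢y) (≡-trans (elem-↭ xs↭ys) (sym (elem-∷-≢ n≢x)))
elem-↭ (trans xs↭ys ys↭zs) = ≡-trans (elem-↭ xs↭ys) (elem-↭ ys↭zs)

mexFrom-cong : ∀ f n {xs ys} → (∀ m → elem m xs ≡ elem m ys) → mexFrom f n xs ≡ mexFrom f n ys
mexFrom-cong zero n eq = refl
mexFrom-cong (suc f) n {xs} {ys} eq with elem n xs | elem n ys | eq n
... | true  | true  | refl = mexFrom-cong f (suc n) eq
... | false | false | refl = refl

mex-↭ : ∀ {xs ys : List ℕ} → xs ↭ ys → mex xs ≡ mex ys
mex-↭ {xs} {ys} xs↭ys = ≡-trans (cong (λ l → mexFrom (suc l) 0 xs) (↭.↭-length xs↭ys))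
                               (mexFrom-cong _ 0 {xs} {ys} (λ _ → elem-↭ xs↭ys))

grundyFuel-stable : ∀ {p f g} → sqSum p < f → sqSum p < g → grundyFuel f p ≡ grundyFuel g p
grundyFuel-stable {p} {suc f} {suc g} (s≤s sp≤f) (s≤s sp≤g) =
  cong mex (map-cong-local (All.map stable (moves-sound p)))
  where
  stable : ∀ {q} → p ⟶ q → grundyFuel f q ≡ grundyFuel g q
  stable mv = grundyFuel-stable (<-≤-trans (⟶-decreases-sqSum mv) sp≤f)
                                (<-≤-trans (⟶-decreases-sqSum mv) sp≤g)

mirror : ℕ → Pos → Pos
mirror c (x , y , z) = (c ∸ z , c ∸ y , c ∸ x)

Bounded : ℕ → Pos → Set
Bounded c (x , y , z) = x ≤ c × y ≤ c × z ≤ c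

transfer-bounded : ∀ {c u v k} → Legal u v k → u ≤ c → u ∸ k ≤ c × v + k ≤ c
transfer-bounded {u = u} {k = k} legal u≤c = ≤-trans (m∸n≤m u k) u≤c , ≤-trans (target≤source legal) u≤c

⟶-preserves-Bounded : ∀ {c p q} → p ⟶ q → Bounded c p → Bounded c q
⟶-preserves-Bounded (a→b legal) (a≤c , _ , c≤c) with transfer-bounded legal a≤c
... | a′≤c , b′≤c = a′≤c , b′≤c , c≤c
⟶-preserves-Bounded (a→c legal) (a≤c , b≤c , _) with transfer-bounded legal a≤c
... | a′≤c , c′≤c = a′≤c , b≤c , c′≤c
⟶-preserves-Bounded (b→a legal) (_ , b≤c , c≤c) with transfer-bounded legal b≤c
... | b′≤c , a′≤c = a′≤c , b′≤c , c≤c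
⟶-preserves-Bounded (b→c legal) (a≤c , b≤c , _) with transfer-bounded legal b≤c
... | b′≤c , c′≤c = a≤c , b′≤c , c′≤c
⟶-preserves-Bounded (c→a legal) (_ , b≤c , c≤c) with transfer-bounded legal c≤c
... | c′≤c , a′≤c = a′≤c , b≤c , c′≤c
⟶-preserves-Bounded (c→b legal) (a≤c , _ , c≤c) with transfer-bounded legal c≤c
... | c′≤c , b′≤c = a≤c , b′≤c , c′≤c

∸-mirror : ∀ {c u} v → u ≤ c → (c ∸ v) ∸ (c ∸ u) ≡ u ∸ v
∸-mirror {c} {u} v u≤c = begin
  (c ∸ v) ∸ (c ∸ u)                ≡⟨ ∸-+-assoc c v (c ∸ u) ⟩
  c ∸ (v + (c ∸ u))                ≡⟨ cong (c ∸_) (+-comm v (c ∸ u)) ⟩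
  c ∸ ((c ∸ u) + v)                ≡⟨ cong (_∸ ((c ∸ u) + v)) (m∸n+n≡m u≤c) ⟨
  ((c ∸ u) + u) ∸ ((c ∸ u) + v)    ≡⟨ [m+n]∸[m+o]≡n∸o (c ∸ u) u v ⟩
  u ∸ v                            ∎
  where open ≡-Reasoning

∸-∸-mirror : ∀ {c u k} → k ≤ u → u ≤ c → c ∸ (u ∸ k) ≡ (c ∸ u) + k
∸-∸-mirror {c} {u} {k} k≤u u≤c = begin
  c ∸ (u ∸ k)                      ≡⟨ cong (_∸ (u ∸ k)) c≡ ⟩
  (c ∸ u) + k + (u ∸ k) ∸ (u ∸ k)  ≡⟨ m+n∸n≡m ((c ∸ u) + k) (u ∸ k) ⟩
  (c ∸ u) + k                      ∎
  where
  open ≡-Reasoning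
  c≡ : c ≡ (c ∸ u) + k + (u ∸ k)
  c≡ = begin
    c                        ≡⟨ m∸n+n≡m u≤c ⟨
    (c ∸ u) + u              ≡⟨ cong ((c ∸ u) +_) (m+[n∸m]≡n k≤u) ⟨
    (c ∸ u) + (k + (u ∸ k))  ≡⟨ +-assoc (c ∸ u) k (u ∸ k) ⟨
    (c ∸ u) + k + (u ∸ k)    ∎

amounts-mirror : ∀ {c u} v → u ≤ c → amounts (c ∸ v) (c ∸ u) ≡ amounts u v
amounts-mirror v u≤c = cong (λ n → range1 (n / 2)) (∸-mirror v u≤c)

map-mirror-transfers : ∀ {c u} v place place′ →
  (∀ s t → mirror c (place s t) ≡ place′ (c ∸ t) (c ∸ s)) → u ≤ c →
  map (mirror c) (transfers place u v) ≡ transfers place′ (c ∸ v) (c ∸ u)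
map-mirror-transfers {c} {u} v place place′ mirror-place u≤c = begin
  map (mirror c) (map (λ k → place (u ∸ k) (v + k)) (amounts u v))
    ≡⟨ map-∘ (amounts u v) ⟨
  map (λ k → mirror c (place (u ∸ k) (v + k))) (amounts u v)
    ≡⟨ map-cong-local (All.tabulate (mirror-transfer ∘ ∈-amounts⁻)) ⟩
  map mirrored (amounts u v)
    ≡⟨ cong (map mirrored) (amounts-mirror v u≤c) ⟨
  map mirrored (amounts (c ∸ v) (c ∸ u))
    ∎
  where
  open ≡-Reasoning
  mirrored : ℕ → Pos
  mirrored k = place′ ((c ∸ v) ∸ k) ((c ∸ u) + k)
  mirror-transfer : ∀ {k} → Legal u v k → mirror c (place (u ∸ k) (v + k)) ≡ mirrored k
  mirror-transfer {k} legal = ≡-trans (mirror-place (u ∸ k) (v + k))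
    (cong₂ place′ (sym (∸-+-assoc c v k)) (∸-∸-mirror (amount≤source legal) u≤c))

map-++-cong : ∀ {A B : Set} {f : A → B} {xs xs′ ys ys′} →
  map f xs ≡ xs′ → map f ys ≡ ys′ → map f (xs ++ ys) ≡ xs′ ++ ys′
map-++-cong {f = f} {xs} refl refl = map-++ f xs _

module _ {A : Set} where
  open CommutativeMonoidSolver (↭.++-commutativeMonoid {A = A})

  shuffle₄₂₆₁₅₃ : (xs₁ xs₂ xs₃ xs₄ xs₅ xs₆ : List A) →
    xs₄ ++ xs₂ ++ xs₆ ++ xs₁ ++ xs₅ ++ xs₃ ↭ xs₁ ++ xs₂ ++ xs₃ ++ xs₄ ++ xs₅ ++ xs₆
  shuffle₄₂₆₁₅₃ = solve 6 (λ a b c d e f → d ⊕ b ⊕ f ⊕ a ⊕ e ⊕ c ⊜ a ⊕ b ⊕ c ⊕ d ⊕ e ⊕ f) ↭-refl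

map-mirror-moves : ∀ {c p} → Bounded c p → map (mirror c) (moves p) ↭ moves (mirror c p)
map-mirror-moves {c} {x , y , z} (x≤c , y≤c , z≤c) = ↭-trans
  (↭-reflexive
    (map-++-cong (map-mirror-transfers y (λ s t → s , t , z) Y→Z (λ _ _ → refl) x≤c)
    (map-++-cong (map-mirror-transfers z (λ s t → s , y , t) X→Z (λ _ _ → refl) x≤c)
    (map-++-cong (map-mirror-transfers x (λ s t → t , s , z) Z→Y (λ _ _ → refl) y≤c)
    (map-++-cong (map-mirror-transfers z (λ s t → x , s , t) X→Y (λ _ _ → refl) y≤c)
    (map-++-cong (map-mirror-transfers x (λ s t → t , y , s) Z→X (λ _ _ → refl) z≤c)
                 (map-mirror-transfers y (λ s t → x , t , s) Y→X (λ _ _ → refl) z≤c)))))))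
  (shuffle₄₂₆₁₅₃ (transfers X→Y X Y) (transfers X→Z X Z) (transfers Y→X Y X)
                 (transfers Y→Z Y Z) (transfers Z→X Z X) (transfers Z→Y Z Y))
  where
  X Y Z : ℕ
  X = c ∸ z
  Y = c ∸ y
  Z = c ∸ x
  X→Y X→Z Y→X Y→Z Z→X Z→Y : ℕ → ℕ → Pos
  X→Y s t = s , t , Z
  X→Z s t = s , Y , t
  Y→X s t = t , s , Z
  Y→Z s t = X , s , t
  Z→X s t = t , Y , s
  Z→Y s t = X , t , s

grundyFuel-mirror : ∀ {c p} f → Bounded c p → grundyFuel f p ≡ grundyFuel f (mirror c p)
grundyFuel-mirror zero _ = refl
grundyFuel-mirror {c} {p} (suc f) bounded = begin
  mex (map (grundyFuel f) (moves p))
    ≡⟨ cong mex (map-cong-local (All.map mirror-move (moves-sound p))) ⟩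
  mex (map (grundyFuel f ∘ mirror c) (moves p))
    ≡⟨ cong mex (map-∘ (moves p)) ⟩
  mex (map (grundyFuel f) (map (mirror c) (moves p)))
    ≡⟨ mex-↭ (↭.map⁺ (grundyFuel f) (map-mirror-moves bounded)) ⟩
  mex (map (grundyFuel f) (moves (mirror c p)))
    ∎
  where
  open ≡-Reasoning
  mirror-move : ∀ {q} → p ⟶ q → grundyFuel f q ≡ grundyFuel f (mirror c q)
  mirror-move mv = grundyFuel-mirror f (⟶-preserves-Bounded mv bounded)

𝒢-mirror : ∀ {c p} → Bounded c p → 𝒢 p ≡ 𝒢 (mirror c p)
𝒢-mirror {c} {p} bounded = begin
  grundyFuel (suc (sqSum p)) p
    ≡⟨ grundyFuel-stable {p} ≤-refl (s≤s (m≤m+n (sqSum p) (sqSum p′))) ⟩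
  grundyFuel fuel p
    ≡⟨ grundyFuel-mirror fuel bounded ⟩
  grundyFuel fuel p′
    ≡⟨ grundyFuel-stable {p′} (s≤s (m≤n+m (sqSum p′) (sqSum p))) ≤-refl ⟩
  grundyFuel (suc (sqSum p′)) p′
    ∎
  where
  open ≡-Reasoning
  p′ = mirror c p
  fuel = suc (sqSum p + sqSum p′)

mainTheorem5 : (a i : ℕ) → 𝒢 (0 , a , 2 * a + i) ≡ 𝒢 (0 , a + i , 2 * a + i)
mainTheorem5 a i = ≡-trans (𝒢-mirror bounded) (cong 𝒢 mirror-image)
  where
  bounded : Bounded (2 * a + i) (0 , a , 2 * a + i)
  bounded = z≤n , ≤-trans (m≤m+n a (a + 0)) (m≤m+n (2 * a) i) , ≤-refl
  regroup : ∀ m n → 2 * m + n ≡ m + n + m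
  regroup = solve-∀
  mirror-image : mirror (2 * a + i) (0 , a , 2 * a + i) ≡ (0 , a + i , 2 * a + i)
  mirror-image = cong₂ _,_ (n∸n≡0 (2 * a + i))
    (cong (_, 2 * a + i) (≡-trans (cong (_∸ a) (regroup a i)) (m+n∸n≡m (a + i) a)))
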